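{- Let $n\ge0$, let $\alpha=(\alpha_1,\ldots,\alpha_n)$, $\beta=(\beta_1,\ldots,\beta_n)$ be partitions with $\alpha_i\le\beta_i$ for $1\le i\le n$, and let $A,B\subseteq\{0,\ldots,n\}$ with $|A|=|B|$. Let $\mathcal B$ be a non-intersecting blue connector and let $\mathcal R$ be its complementary red connector. Then every node lying on both a path of $\mathcal B$ and a path of $\mathcal R$ is a node from which some path of $\mathcal B$ takes a vertical step.
   Context: A partition with $n$ parts is a weakly decreasing sequence of $n$ nonnegative integers. Points have coordinates $(i,j)\in\mathbb Z^2$, $i$ increasing downward, $j$ increasing rightward. The box $[i,j]$ is the unit square with corners $(i-1,j-1),(i-1,j),(i,j-1),(i,j)$, and $Y(\beta/\alpha)=\{[i,j]:1\le i\le n,\ \alpha_i+1\le j\le\beta_i\}$. Both lattices below have as nodes all corners of boxes of $Y(\beta/\alpha)$. In $\Lambda_{\mathrm L}(\beta/\alpha)$ the edges are, for each box $[i,j]\in Y(\beta/\alpha)$: horizontal edges $(i-1,j-1)\to(i-1,j)$ and $(i,j-1)\to(i,j)$ (weight $1$) and the vertical edge $(i-1,j)\to(i,j)$ (weight $x_j$). In $\Lambda_{\mathrm R}(\beta/\alpha)$ the edges are, for each box $[i,j]\in Y(\beta/\alpha)$: horizontal edges $(i-1,j)\to(i-1,j-1)$ and $(i,j)\to(i,j-1)$ (weight $1$) and the diagonal edge $(i-1,j)\to(i,j-1)$ (weight $x_j$). Let $A^{\mathsf c},B^{\mathsf c}$ be the complements in $\{0,\ldots,n\}$, and set $\alpha_{n+1}:=\alpha_n$,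 $\beta_0:=\beta_1$. Blue sources: $(a,\alpha_{a+1})$, $a\in A$; blue sinks: $(b,\beta_b)$, $b\in B$; red sources: $(b',\beta_{b'})$, $b'\in B^{\mathsf c}$; red sinks: $(a',\alpha_{a'+1})$, $a'\in A^{\mathsf c}$. A blue connector is a family of directed paths in $\Lambda_{\mathrm L}(\beta/\alpha)$, one from each blue source, ending at pairwise distinct blue sinks; it is non-intersecting if no two of its paths share a node. The complementary red connector of a non-intersecting blue connector $\mathcal B$ is the family of paths in $\Lambda_{\mathrm R}(\beta/\alpha)$ obtained as follows: starting at each red source, repeatedly take, from the current node, the diagonal edge of $\Lambda_{\mathrm R}(\beta/\alpha)$ if some path of $\mathcal B$ takes a vertical step from that node, and otherwise the horizontal edge of $\Lambda_{\mathrm R}(\beta/\alpha)$ out of that node, stopping when the required edge does not exist. -}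

module Defs where

open import Data.Nat using (ℕ; zero; suc; _+_; _∸_; _≤_)
open import Data.Product using (Σ; ∃; _×_; _,_)
open import Data.Sum using (_⊎_)
open import Data.Empty using (⊥)
open import Data.Fin using (Fin; toℕ)
open import Data.Fin.Subset using (Subset; _∈_; _∉_)
open import Data.Vec using (Vec; []; _∷_; lookup)
open import Relation.Nullary using (¬_)
open import Relation.Binary.PropositionalEquality using (_≡_; _≢_)

-- Points (i , j) : i = row (increasing downward), j = column (increasing rightward).
-- All points relevant to the statement have nonnegative coordinates.
Point : Set
Point = ℕ × ℕ

-- 0-based lookup, clamped at the last entry; returns 0 for the empty vector.
get0 : ∀ {n} → Vec ℕ n → ℕ → ℕ
get0 [] _ = 0
get0 (x ∷ []) _ = x
get0 (x ∷ y ∷ xs) zero = x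
get0 (x ∷ y ∷ xs) (suc k) = get0 (y ∷ xs) k

-- 1-based lookup v_i, with the conventions v_0 := v_1 and v_{n+1} := v_n.
get : ∀ {n} → Vec ℕ n → ℕ → ℕ
get v i = get0 v (i ∸ 1)

IsPartition : ∀ {n} → Vec ℕ n → Set
IsPartition {n} v = (i j : Fin n) → toℕ i ≤ toℕ j → lookup v j ≤ lookup v i

data Path (E : Point → Point → Set) : Point → Point → Set where
  here : ∀ {p} → Path E p p
  step : ∀ {p q r} → E p q → Path E q r → Path E p r

OnPath : ∀ {E p q} → Path E p q → Point → Set
OnPath {p = p} here v = p ≡ v
OnPath {p = p} (step e r) v = (p ≡ v) ⊎ OnPath r v

below : Point → Point
below (i , j) = (suc i , j)

VStepFrom : ∀ {E p q} → Path E p q → Point → Set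
VStepFrom here v = ⊥
VStepFrom (step {p} {q} e r) v = (p ≡ v × q ≡ below v) ⊎ VStepFrom r v

module Setup {n : ℕ} (α β : Vec ℕ n) (A B : Subset (suc n)) where

  InY : ℕ → ℕ → Set
  InY i j = (1 ≤ i) × (i ≤ n) × (get α i + 1 ≤ j) × (j ≤ get β i)

  IsNode : Point → Set
  IsNode (i , j) = Σ ℕ λ i' → Σ ℕ λ j' →
    InY i' j' × (i' ≡ i ⊎ i' ≡ suc i) × (j' ≡ j ⊎ j' ≡ suc j)

  data EdgeL : Point → Point → Set where
    hTop  : ∀ {i j} → InY (suc i) (suc j) → EdgeL (i , j) (i , suc j)
    hBot  : ∀ {i j} → InY (suc i) (suc j) → EdgeL (suc i , j) (suc i , suc j)
    vert  : ∀ {i j} → InY (suc i) (suc j) → EdgeL (i , suc j) (suc i , suc j)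

  data EdgeR : Point → Point → Set where
    hTop  : ∀ {i j} → InY (suc i) (suc j) → EdgeR (i , suc j) (i , j)
    hBot  : ∀ {i j} → InY (suc i) (suc j) → EdgeR (suc i , suc j) (suc i , j)
    diag  : ∀ {i j} → InY (suc i) (suc j) → EdgeR (i , suc j) (suc i , j)

  blueSource : Fin (suc n) → Point
  blueSource a = (toℕ a , get α (suc (toℕ a)))

  blueSink : Fin (suc n) → Point
  blueSink b = (toℕ b , get β (toℕ b))

  redSource : Fin (suc n) → Point
  redSource b' = (toℕ b' , get β (toℕ b'))

  redSink : Fin (suc n) → Point
  redSink a' = (toℕ a' , get α (suc (toℕ a')))

  record BlueConnector : Set where
    field
      sink     : (a : Fin (suc n)) → a ∈ A → Fin (suc n)
      sink∈B   : (a : Fin (suc n)) (h : a ∈ A) → sink a h ∈ B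
      distinct : (a a' : Fin (suc n)) (h : a ∈ A) (h' : a' ∈ A) →
                 a ≢ a' → sink a h ≢ sink a' h'
      path     : (a : Fin (suc n)) (h : a ∈ A) →
                 Path EdgeL (blueSource a) (blueSink (sink a h))

  open BlueConnector public

  NonIntersecting : BlueConnector → Set
  NonIntersecting 𝓑 = (a a' : Fin (suc n)) (h : a ∈ A) (h' : a' ∈ A) → a ≢ a' →
    (v : Point) → OnPath (path 𝓑 a h) v → ¬ OnPath (path 𝓑 a' h') v

  BlueVert : BlueConnector → Point → Set
  BlueVert 𝓑 v = Σ (Fin (suc n)) λ a → Σ (a ∈ A) λ h → VStepFrom (path 𝓑 a h) v

  diagOf : Point → Point
  diagOf (i , j) = (suc i , j ∸ 1)

  leftOf : Point → Point
  leftOf (i , j) = (i , j ∸ 1)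

  Required : BlueConnector → Point → Point → Set
  Required 𝓑 v q = (BlueVert 𝓑 v × q ≡ diagOf v) ⊎ (¬ BlueVert 𝓑 v × q ≡ leftOf v)

  FollowsRule : (𝓑 : BlueConnector) → ∀ {p q} → Path EdgeR p q → Set
  FollowsRule 𝓑 {p} here = ¬ (Σ Point λ q → Required 𝓑 p q × EdgeR p q)
  FollowsRule 𝓑 {p} (step {q = q} e r) = Required 𝓑 p q × FollowsRule 𝓑 r

  record RedFamily : Set where
    field
      end   : (b' : Fin (suc n)) → b' ∉ B → Point
      rpath : (b' : Fin (suc n)) (h : b' ∉ B) → Path EdgeR (redSource b') (end b' h)

  open RedFamily public

  IsComplementaryRed : BlueConnector → RedFamily → Set
  IsComplementaryRed 𝓑 𝓡 = (b' : Fin (suc n)) (h : b' ∉ B) → FollowsRule 𝓑 (rpath 𝓡 b' h)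

module Submission where

open import Defs
open import Data.Nat using (ℕ; zero; suc; _+_; _≤_; _<_; _≟_; s≤s; z≤n)
open import Data.Nat.Properties using (≤-refl; ≤-reflexive; <-irrefl; <-trans; <-≤-trans; n≮n; +-suc)
open import Data.Product using (Σ; _×_; _,_; proj₁)
open import Data.Product.Properties using (≡-dec)
open import Data.Sum using (_⊎_; inj₁; inj₂)
open import Data.Empty using (⊥-elim)
open import Data.Fin using (Fin; toℕ)
open import Data.Fin.Properties using (toℕ-injective)
import Data.Fin as Fin
open import Data.Fin.Subset using (Subset; _∈_; _∉_; ∣_∣)
open import Data.Vec using (Vec; lookup; []; _∷_; here; there)
open import Relation.Nullary using (¬_; Dec; yes; no)
open import Relation.Nullary.Decidable using (_×-dec_; _⊎-dec_)
open import Relation.Binary.Definitions using (DecidableEquality)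
open import Relation.Binary.PropositionalEquality using (_≡_; refl; sym; cong; subst)

-- Call a node good if, whenever a blue path passes through it, some blue path steps down
-- from it. Red sources are good: a blue path through (b', β_b') does not end there since
-- b' ∉ B, and cannot go right since β_b' bounds its row. Goodness survives every red move.
-- A left move to q is taken only from a node p without a blue vertical step; a blue path
-- leaving q rightwards would pass through p, and p is good. A diagonal move goes from
-- p = (i, j+1) to q = (i+1, j) while some blue path steps down to (i+1, j+1); a blue
-- path leaving q rightwards also reaches (i+1, j+1), hence is that same path, which would
-- then visit both p and q although i + j strictly increases along paths of Λ_L. Nodes
-- strictly inside a row cannot be blue sinks, so a blue path through q does leave it.

∈-irrelevant : ∀ {m} {p : Subset m} {x : Fin m} (h h′ : x ∈ p) → h ≡ h′
∈-irrelevant here      here       = refl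
∈-irrelevant (there h) (there h′) = cong there (∈-irrelevant h h′)

partition-tail : ∀ {m x} {xs : Vec ℕ m} → IsPartition (x ∷ xs) → IsPartition xs
partition-tail P i j i≤j = P (Fin.suc i) (Fin.suc j) (s≤s i≤j)

get0-antitone : ∀ {m} (v : Vec ℕ m) → IsPartition v → ∀ {k} → suc k < m →
                get0 v (suc k) ≤ get0 v k
get0-antitone (_ ∷ [])         _ (s≤s ())
get0-antitone (x ∷ y ∷ [])     P {zero}  _          = P Fin.zero (Fin.suc Fin.zero) z≤n
get0-antitone (x ∷ y ∷ _ ∷ _) P {zero}  _          = P Fin.zero (Fin.suc Fin.zero) z≤n
get0-antitone (x ∷ y ∷ xs)     P {suc k} (s≤s k<m) = get0-antitone (y ∷ xs) (partition-tail P) k<m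

get-antitone : ∀ {m} (v : Vec ℕ m) → IsPartition v → ∀ {i} → i < m → get v (suc i) ≤ get v i
get-antitone v P {zero}  _   = ≤-refl
get-antitone v P {suc k} k<m = get0-antitone v P k<m

_≟ₚ_ : DecidableEquality Point
_≟ₚ_ = ≡-dec _≟_ _≟_

module _ {E : Point → Point → Set} where

  OnPath-start : ∀ {p q} (r : Path E p q) → OnPath r p
  OnPath-start here       = refl
  OnPath-start (step _ _) = inj₁ refl

  VStepFrom⇒OnPath : ∀ {p q v} (r : Path E p q) → VStepFrom r v → OnPath r v
  VStepFrom⇒OnPath (step _ _) (inj₁ (refl , _)) = inj₁ refl
  VStepFrom⇒OnPath (step _ r) (inj₂ s)          = inj₂ (VStepFrom⇒OnPath r s)

  VStepFrom⇒OnPath-below : ∀ {p q v} (r : Path E p q) → VStepFrom r v → OnPath r (below v)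
  VStepFrom⇒OnPath-below (step _ r) (inj₁ (refl , refl)) = inj₂ (OnPath-start r)
  VStepFrom⇒OnPath-below (step _ r) (inj₂ s)             = inj₂ (VStepFrom⇒OnPath-below r s)

  VStepFrom? : ∀ {p q} (r : Path E p q) v → Dec (VStepFrom r v)
  VStepFrom? here v = no λ ()
  VStepFrom? (step {p} {q} _ r) v = ((p ≟ₚ v) ×-dec (q ≟ₚ below v)) ⊎-dec VStepFrom? r v

module RankedPath {E : Point → Point → Set} (rank : Point → ℕ)
                  (rank-< : ∀ {p q} → E p q → rank p < rank q) where

  start-or-above : ∀ {p q x} (r : Path E p q) → OnPath r x → p ≡ x ⊎ rank p < rank x
  start-or-above here       p≡x       = inj₁ p≡x
  start-or-above (step _ _) (inj₁ p≡x) = inj₁ p≡x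
  start-or-above (step e r) (inj₂ o) with start-or-above r o
  ... | inj₁ refl = inj₂ (rank-< e)
  ... | inj₂ lt   = inj₂ (<-trans (rank-< e) lt)

  OnPath-rank-injective : ∀ {p q x y} (r : Path E p q) → OnPath r x → OnPath r y →
                          rank x ≡ rank y → x ≡ y
  OnPath-rank-injective here       refl     refl     _  = refl
  OnPath-rank-injective (step e r) (inj₁ refl) oy    eq with start-or-above (step e r) oy
  ... | inj₁ x≡y = x≡y
  ... | inj₂ lt  = ⊥-elim (<-irrefl eq lt)
  OnPath-rank-injective (step e r) (inj₂ ox) (inj₁ refl) eq =
    sym (OnPath-rank-injective (step e r) (inj₁ refl) (inj₂ ox) (sym eq))
  OnPath-rank-injective (step e r) (inj₂ ox) (inj₂ oy)   eq = OnPath-rank-injective r ox oy eq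

module Lattice {n : ℕ} (α β : Vec ℕ n) (A B : Subset (suc n)) where
  open Setup α β A B

  right : Point → Point
  right (i , j) = (i , suc j)

  antidiagonal : Point → ℕ
  antidiagonal (i , j) = i + j

  EdgeL-antidiagonal-< : ∀ {p q} → EdgeL p q → antidiagonal p < antidiagonal q
  EdgeL-antidiagonal-< (hTop {i} {j} _) = ≤-reflexive (sym (+-suc i j))
  EdgeL-antidiagonal-< (hBot {i} {j} _) = ≤-reflexive (sym (+-suc (suc i) j))
  EdgeL-antidiagonal-< (vert _)         = ≤-refl

  open RankedPath {EdgeL} antidiagonal (λ {p} {q} → EdgeL-antidiagonal-< {p} {q}) public

  leaves-rightward : ∀ {p q w} (r : Path EdgeL p q) → OnPath r w → ¬ VStepFrom r w →
                     q ≡ w ⊎ (EdgeL w (right w) × OnPath r (right w))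
  leaves-rightward here                  refl       _  = inj₁ refl
  leaves-rightward (step (hTop b) r)     (inj₁ refl) _  = inj₂ (hTop b , inj₂ (OnPath-start r))
  leaves-rightward (step (hBot b) r)     (inj₁ refl) _  = inj₂ (hBot b , inj₂ (OnPath-start r))
  leaves-rightward (step (vert _) _)     (inj₁ refl) nv = ⊥-elim (nv (inj₁ (refl , refl)))
  leaves-rightward (step e r)            (inj₂ o)    nv with leaves-rightward r o (λ s → nv (inj₂ s))
  ... | inj₁ q≡w        = inj₁ q≡w
  ... | inj₂ (e′ , o′) = inj₂ (e′ , inj₂ o′)

  InsideRow : Point → Set
  InsideRow (i , j) = j < get β i

  rowEnd-not-inside : ∀ i → ¬ InsideRow (i , get β i)
  rowEnd-not-inside i = n≮n (get β i)

  module _ (Pβ : IsPartition β) where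

    box-top-inside : ∀ {i j} → InY (suc i) (suc j) → InsideRow (i , j)
    box-top-inside (_ , i<n , _ , j<β) = <-≤-trans j<β (get-antitone β Pβ i<n)

    box-bottom-inside : ∀ {i j} → InY (suc i) (suc j) → InsideRow (suc i , j)
    box-bottom-inside (_ , _ , _ , j<β) = j<β

    EdgeL-right⇒inside : ∀ {w} → EdgeL w (right w) → InsideRow w
    EdgeL-right⇒inside (hTop b) = box-top-inside b
    EdgeL-right⇒inside (hBot b) = box-bottom-inside b

    EdgeR-target-inside : ∀ {p q} → EdgeR p q → InsideRow q
    EdgeR-target-inside (hTop b) = box-top-inside b
    EdgeR-target-inside (hBot b) = box-bottom-inside b
    EdgeR-target-inside (diag b) = box-bottom-inside b

module Invariant {n : ℕ} (α β : Vec ℕ n) (A B : Subset (suc n)) (Pβ : IsPartition β)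
                 (𝓑 : Setup.BlueConnector α β A B) (ni : Setup.NonIntersecting α β A B 𝓑) where
  open Setup α β A B
  open Lattice α β A B

  OnBlue : Point → Set
  OnBlue v = Σ (Fin (suc n)) λ a → Σ (a ∈ A) λ h → OnPath (path 𝓑 a h) v

  VerticalIfBlue : Point → Set
  VerticalIfBlue v = OnBlue v → BlueVert 𝓑 v

  blue-vertical-or-rightward : ∀ {a h w} → InsideRow w → OnPath (path 𝓑 a h) w →
                               VStepFrom (path 𝓑 a h) w ⊎ OnPath (path 𝓑 a h) (right w)
  blue-vertical-or-rightward {a} {h} {w} inside o with VStepFrom? (path 𝓑 a h) w
  ... | yes vs = inj₁ vs
  ... | no nv with leaves-rightward (path 𝓑 a h) o nv
  ...   | inj₁ refl     = ⊥-elim (rowEnd-not-inside (toℕ (sink 𝓑 a h)) inside)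
  ...   | inj₂ (_ , o′) = inj₂ o′

  redSource-VerticalIfBlue : ∀ {b′} → b′ ∉ B → VerticalIfBlue (redSource b′)
  redSource-VerticalIfBlue {b′} b′∉B (a , h , o) with VStepFrom? (path 𝓑 a h) (redSource b′)
  ... | yes vs = a , h , vs
  ... | no nv with leaves-rightward (path 𝓑 a h) o nv
  ...   | inj₁ sink≡b′ =
    ⊥-elim (b′∉B (subst (_∈ B) (toℕ-injective (cong proj₁ sink≡b′)) (sink∈B 𝓑 a h)))
  ...   | inj₂ (e , _) = ⊥-elim (rowEnd-not-inside (toℕ b′) (EdgeL-right⇒inside Pβ e))

  no-bypass-below-vertical : ∀ {a a′ h h′ i j} → VStepFrom (path 𝓑 a′ h′) (i , suc j) →
    OnPath (path 𝓑 a h) (suc i , j) → ¬ OnPath (path 𝓑 a h) (suc i , suc j)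
  no-bypass-below-vertical {a} {a′} {h} {h′} {i} {j} vs oq o→ with a Fin.≟ a′
  ... | no a≢a′ = ni a a′ h h′ a≢a′ _ o→ (VStepFrom⇒OnPath-below (path 𝓑 a′ h′) vs)
  ... | yes refl with ∈-irrelevant h h′
  ...   | refl with OnPath-rank-injective (path 𝓑 a h) oq (VStepFrom⇒OnPath (path 𝓑 a h) vs)
                                          (sym (+-suc i j))
  ...     | ()

  not-rightward-of-red-target : ∀ {a h p q} → EdgeR p q → Required 𝓑 p q → VerticalIfBlue p →
    OnPath (path 𝓑 a h) q → ¬ OnPath (path 𝓑 a h) (right q)
  not-rightward-of-red-target (hTop _) (inj₁ (_ , ()))
  not-rightward-of-red-target (hBot _) (inj₁ (_ , ()))
  not-rightward-of-red-target (diag _) (inj₂ (_ , ()))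
  not-rightward-of-red-target (hTop _) (inj₂ (¬vert , refl)) good _ o→ = ¬vert (good (_ , _ , o→))
  not-rightward-of-red-target (hBot _) (inj₂ (¬vert , refl)) good _ o→ = ¬vert (good (_ , _ , o→))
  not-rightward-of-red-target (diag _) (inj₁ ((_ , _ , vs) , refl)) _ =
    no-bypass-below-vertical vs

  VerticalIfBlue-step : ∀ {p q} → EdgeR p q → Required 𝓑 p q →
                        VerticalIfBlue p → VerticalIfBlue q
  VerticalIfBlue-step e req good (a , h , o)
    with blue-vertical-or-rightward (EdgeR-target-inside Pβ e) o
  ... | inj₁ vs = a , h , vs
  ... | inj₂ o→ = ⊥-elim (not-rightward-of-red-target e req good o o→)

  VerticalIfBlue-along : ∀ {p q v} (r : Path EdgeR p q) → FollowsRule 𝓑 r →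
                         VerticalIfBlue p → OnPath r v → VerticalIfBlue v
  VerticalIfBlue-along here             _            good refl        = good
  VerticalIfBlue-along (step _ _)       _            good (inj₁ refl) = good
  VerticalIfBlue-along (step e r) (req , follows) good (inj₂ o)    =
    VerticalIfBlue-along r follows (VerticalIfBlue-step e req good) o

lemma2p6 : (n : ℕ) (α β : Vec ℕ n) → IsPartition α → IsPartition β →
    ((i : Fin n) → lookup α i ≤ lookup β i) →
    (A B : Subset (suc n)) → ∣ A ∣ ≡ ∣ B ∣ →
    (𝓑 : Setup.BlueConnector α β A B) → Setup.NonIntersecting α β A B 𝓑 →
    (𝓡 : Setup.RedFamily α β A B) → Setup.IsComplementaryRed α β A B 𝓑 𝓡 →
    (v : Point) → Setup.IsNode α β A B v →
    (Σ (Fin (suc n)) λ a → Σ (a ∈ A) λ h → OnPath (Setup.BlueConnector.path 𝓑 a h) v) →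
    (Σ (Fin (suc n)) λ b' → Σ (b' ∉ B) λ h → OnPath (Setup.RedFamily.rpath 𝓡 b' h) v) →
    Setup.BlueVert α β A B 𝓑 v
lemma2p6 n α β _ Pβ _ A B _ 𝓑 ni 𝓡 complementary v _ onBlue (b′ , b′∉B , onRed) =
  VerticalIfBlue-along (rpath 𝓡 b′ b′∉B) (complementary b′ b′∉B)
                       (redSource-VerticalIfBlue b′∉B) onRed onBlue
  where
  open Setup α β A B
  open Invariant α β A B Pβ 𝓑 ni
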